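{- Let $0<a_1<a_2<a_3$ be integers with $\gcd(a_1,a_2)=1$, and let $b_{ -1},b'_{ -1},b_0,b'_0,\dots$ and $k$ be produced by the procedure described in the context, where it is assumed that $b_0>0$ (so that the iteration is started) and that the iteration halts after $k$ rounds. Then $$G(a_1,a_2,a_3)=\begin{cases} b_{k}a_1+b'_{k-1}a_2-\min(b_{k-1}a_1,\,b'_{k}a_2) & \text{if } k \text{ is odd},\\ b_{k-1}a_1+b'_{k}a_2-\min(b_{k}a_1,\,b'_{k-1}a_2) & \text{if } k \text{ is even}.\end{cases}$$
   Context: For positive integers $a_1,a_2,a_3$ with $\gcd(a_1,a_2,a_3)=1$, $G(a_1,a_2,a_3)$ denotes the largest integer that cannot be written as $a_1x_1+a_2x_2+a_3x_3$ with positive integers $x_1,x_2,x_3$. Procedure: set $b_{ -1}=a_2$ and $b'_{ -1}=a_1$. Let $b'_0,b_0$ be the unique integers with $0<b'_0\le a_1$ and $a_3=a_2b'_0-a_1b_0$. Assuming $b_0>0$, for $i=0,1,2,\dots$ do the following: if $b_i=0$ or $b'_i=0$, halt and set $k=i$. Otherwise let $q_i=\lfloor b_{i-1}/b_i\rfloor$, $q'_i=\lfloor b'_{i-1}/b'_i\rfloor$, $m_i=\min(q_i,q'_i)$, and define $b_{i+1}=b_{i-1}-m_ib_i$, $b'_{i+1}=b'_{i-1}-m_ib'_i$; if $q_i\neq q'_i$, halt and set $k=i+1$; otherwise continue with $i+1$. "The iteration halts after $k$ rounds" means it halts with this value of $k$. -}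

module Defs where

open import Data.Nat using (ℕ; zero; suc; _+_; _*_; _∸_; _<_; _⊓_)
open import Data.Nat.DivMod using (_/_)
open import Data.Integer using (ℤ; +_) renaming (_<_ to _<ℤ_)
open import Data.Product using (Σ; ∃; _×_; _,_; proj₁; proj₂)
open import Relation.Binary.PropositionalEquality using (_≡_)
open import Relation.Nullary using (¬_)
open import Data.Sum using (_⊎_)

-- n is representable as a1 x1 + a2 x2 + a3 x3 with POSITIVE integers x1,x2,x3
-- (x_i = suc y_i with y_i : ℕ).
RepPos : ℕ → ℕ → ℕ → ℤ → Set
RepPos a1 a2 a3 n =
  ∃ λ y1 → ∃ λ y2 → ∃ λ y3 → n ≡ + (a1 * suc y1 + a2 * suc y2 + a3 * suc y3)

IsG : ℕ → ℕ → ℕ → ℤ → Set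
IsG a1 a2 a3 g = ¬ RepPos a1 a2 a3 g × (∀ n → g <ℤ n → RepPos a1 a2 a3 n)

-- floor division, with the (unused) convention ⌊m/0⌋ = 0
quot : ℕ → ℕ → ℕ
quot m zero    = 0
quot m (suc n) = m / suc n

-- State at round i: (b_{i-1}, b_i, b'_{i-1}, b'_i)
record State : Set where
  constructor st
  field
    bPrev  : ℕ
    b      : ℕ
    b'Prev : ℕ
    b'     : ℕ
open State public

q : State → ℕ
q s = quot (bPrev s) (b s)

q' : State → ℕ
q' s = quot (b'Prev s) (b' s)

step : State → State
step s = st (b s) (bPrev s ∸ m * b s) (b' s) (b'Prev s ∸ m * b' s)
  where m = q s ⊓ q' s

sts : ℕ → ℕ → ℕ → ℕ → ℕ → State
sts a1 a2 b0 b'0 zero    = st a2 b0 a1 b'0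
sts a1 a2 b0 b'0 (suc i) = step (sts a1 a2 b0 b'0 i)

HaltsAfter : ℕ → ℕ → ℕ → ℕ → ℕ → Set
HaltsAfter a1 a2 b0 b'0 k =
  ( (∀ i → i < k → ¬ b (S i) ≡ 0 × ¬ b' (S i) ≡ 0 × q (S i) ≡ q' (S i))
    × (b (S k) ≡ 0 ⊎ b' (S k) ≡ 0) )
  ⊎
  -- halt at round j with k = j + 1 because q_j ≠ q'_j, having continued at all i < j
  ( Σ ℕ λ j → k ≡ suc j
      × (∀ i → i < j → ¬ b (S i) ≡ 0 × ¬ b' (S i) ≡ 0 × q (S i) ≡ q' (S i))
      × ¬ b (S j) ≡ 0 × ¬ b' (S j) ≡ 0 × ¬ q (S j) ≡ q' (S j) )
  where
  S = sts a1 a2 b0 b'0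

oddFormula : ℕ → ℕ → State → ℤ
oddFormula a1 a2 S =
  + (b S * a1 + b'Prev S * a2) Data.Integer.- + ((bPrev S * a1) ⊓ (b' S * a2))
  where import Data.Integer

evenFormula : ℕ → ℕ → State → ℤ
evenFormula a1 a2 S =
  + (bPrev S * a1 + b' S * a2) Data.Integer.- + ((b S * a1) ⊓ (b'Prev S * a2))
  where import Data.Integer

-- The triples x with a1 x1 + a2 x2 + a3 x3 = 0 form a lattice. The iteration keeps a basis
-- (A, -A', -P), (-B, B', -Q) of it, where (A, B, A', B') = (b_{i-1}, b_i, b'_{i-1}, b'_i) up to
-- exchanging the roles of a1 and a2 at odd rounds, and P, Q > 0. When it halts the basis is
-- "L-shaped" (B ≤ A and A' ≤ B', or B = 0), and then the region [0,A) × [0,B') minus the corner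
-- [A-B,A) × [B'-A',B') is a fundamental domain: moving along the basis vectors brings every
-- a1 x1 + a2 x2 into the region at the cost of positive multiples of a3, while two points of the
-- region never differ by a lattice vector with positive third coordinate (a sign analysis of the
-- coordinates in the basis). So G is the largest a1 (r1 + 1) + a2 (r2 + 1) over the region, which
-- is attained at one of its two inner corners and gives the formula.
module Submission where

open import Defs
open import Data.Nat.GCD using (gcd; GCD; gcd-GCD; module Bézout)
open import Data.List using (_∷_; [])
open import Data.Product using (Σ; ∃; ∃₂; _×_; _,_; proj₁; proj₂)
open import Relation.Binary.PropositionalEquality
  using (_≡_; _≢_; refl; sym; trans; cong; cong₂; subst; module ≡-Reasoning)

module Lattice where

  open import Data.Nat as ℕ using (ℕ; suc; NonZero)
  open import Data.Integer as ℤ using (ℤ; +_; -[1+_]; 1ℤ; _+_; _*_; _-_; -_)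
  import Data.Integer.Properties as ℤ
  open import Data.Integer.Tactic.RingSolver using (solve)
  open ≡-Reasoning

  pos-part neg-part : ℤ → ℕ
  pos-part (+ n)    = n
  pos-part -[1+ n ] = 0
  neg-part (+ n)    = 0
  neg-part -[1+ n ] = suc n

  pos-neg-parts : ∀ i → i ≡ + pos-part i - + neg-part i
  pos-neg-parts (+ n)    = sym (ℤ.+-identityʳ (+ n))
  pos-neg-parts -[1+ n ] = refl

  pos-linear : ∀ a x b y → + (a ℕ.* x ℕ.+ b ℕ.* y) ≡ + a * + x + + b * + y
  pos-linear a x b y = trans (ℤ.pos-+ (a ℕ.* x) (b ℕ.* y)) (cong₂ _+_ (ℤ.pos-* a x) (ℤ.pos-* b y))

  pos-shifted-linear : ∀ x a X b Y → + (x ℕ.+ (a ℕ.* X ℕ.+ b ℕ.* Y)) ≡ + x + (+ a * + X + + b * + Y)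
  pos-shifted-linear x a X b Y = trans (ℤ.pos-+ x _) (cong (_+_ (+ x)) (pos-linear a X b Y))

  cast-product≡sum : ∀ a x b y c z → a ℕ.* x ≡ b ℕ.* y ℕ.+ c ℕ.* z → + a * + x ≡ + b * + y + + c * + z
  cast-product≡sum a x b y c z e = trans (sym (ℤ.pos-* a x)) (trans (cong +_ e) (pos-linear b y c z))

  cast-product≡shift : ∀ a x c y z → a ℕ.* x ≡ c ℕ.+ y ℕ.* z → + a * + x ≡ + c + + y * + z
  cast-product≡shift a x c y z e =
    trans (sym (ℤ.pos-* a x)) (trans (cong +_ e) (trans (ℤ.pos-+ c _) (cong (_+_ (+ c)) (ℤ.pos-* y z))))

  cast-linear : ∀ a1 x1 a2 x2 a3 t p1 p2 → a1 ℕ.* x1 ℕ.+ a2 ℕ.* x2 ℕ.+ a3 ℕ.* t ≡ a1 ℕ.* p1 ℕ.+ a2 ℕ.* p2 →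
                + a1 * + x1 + + a2 * + x2 + + a3 * + t ≡ + a1 * + p1 + + a2 * + p2
  cast-linear a1 x1 a2 x2 a3 t p1 p2 e =
    trans (sym (trans (ℤ.pos-+ (a1 ℕ.* x1 ℕ.+ a2 ℕ.* x2) (a3 ℕ.* t)) (cong₂ _+_ (pos-linear a1 x1 a2 x2) (ℤ.pos-* a3 t))))
          (trans (cong +_ e) (pos-linear a1 p1 a2 p2))

  isolate : ∀ X Y Z → X ≡ Y + Z → Z ≡ X - Y
  isolate X Y Z e = begin
    Z             ≡⟨ solve (Z ∷ Y ∷ []) ⟩
    (Y + Z) - Y   ≡⟨ cong (_- Y) e ⟨
    X - Y ∎

  displacement : ∀ a1 a2 a3 x1 x2 t p1 p2 → a1 * x1 + a2 * x2 + a3 * t ≡ a1 * p1 + a2 * p2 →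
                 a3 * t ≡ - (a1 * (x1 - p1) + a2 * (x2 - p2))
  displacement a1 a2 a3 x1 x2 t p1 p2 e = begin
    a3 * t                                              ≡⟨ solve (a1 ∷ x1 ∷ a2 ∷ x2 ∷ a3 ∷ t ∷ []) ⟩
    (a1 * x1 + a2 * x2 + a3 * t) - (a1 * x1 + a2 * x2)  ≡⟨ cong (_- (a1 * x1 + a2 * x2)) e ⟩
    (a1 * p1 + a2 * p2) - (a1 * x1 + a2 * x2)           ≡⟨ solve (a1 ∷ p1 ∷ a2 ∷ p2 ∷ x1 ∷ x2 ∷ []) ⟩
    - (a1 * (x1 - p1) + a2 * (x2 - p2)) ∎

  unit-difference : ∀ X A Y B → 1ℤ + Y * B ≡ X * A → X * A + - Y * B ≡ 1ℤ
  unit-difference X A Y B e = begin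
    X * A + - Y * B        ≡⟨ cong (_+ - Y * B) e ⟨
    1ℤ + Y * B + - Y * B   ≡⟨ solve (Y ∷ B ∷ []) ⟩
    1ℤ ∎

  bezout-ℤ : ∀ {a1 a2} → Bézout.Identity 1 a1 a2 → ∃₂ λ u w → u * + a1 + w * + a2 ≡ 1ℤ
  bezout-ℤ {a1} {a2} (Bézout.+- x y eq) =
    + x , - + y , unit-difference (+ x) (+ a1) (+ y) (+ a2) (sym (cast-product≡shift x a1 1 y a2 (sym eq)))
  bezout-ℤ {a1} {a2} (Bézout.-+ x y eq) =
    - + x , + y , trans (ℤ.+-comm (- + x * + a1) (+ y * + a2))
      (unit-difference (+ y) (+ a2) (+ x) (+ a1) (sym (cast-product≡shift y a2 1 x a1 (sym eq))))

  shift-difference : ∀ x p ap an bp bn A B → x - p ≡ (ap - an) * A - (bp - bn) * B →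
                     x + (an * A + bp * B) ≡ p + (ap * A + bn * B)
  shift-difference x p ap an bp bn A B e = begin
    x + (an * A + bp * B)                                   ≡⟨ solve (x ∷ p ∷ an ∷ A ∷ bp ∷ B ∷ []) ⟩
    (x - p) + (an * A + bp * B) + p                         ≡⟨ cong (λ d → d + (an * A + bp * B) + p) e ⟩
    ((ap - an) * A - (bp - bn) * B) + (an * A + bp * B) + p ≡⟨ solve (ap ∷ an ∷ A ∷ bp ∷ bn ∷ B ∷ p ∷ []) ⟩
    p + (ap * A + bn * B) ∎

  shift-sum : ∀ t ap an bp bn P Q → t ≡ - ((ap - an) * P + (bp - bn) * Q) →
              t + (ap * P + bp * Q) ≡ an * P + bn * Q
  shift-sum t ap an bp bn P Q e = begin
    t + (ap * P + bp * Q)                                 ≡⟨ cong (_+ (ap * P + bp * Q)) e ⟩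
    - ((ap - an) * P + (bp - bn) * Q) + (ap * P + bp * Q) ≡⟨ solve (ap ∷ an ∷ P ∷ bp ∷ bn ∷ Q ∷ []) ⟩
    an * P + bn * Q ∎

  balanced-difference : ∀ x p α β A B → + x - + p ≡ α * + A - β * + B →
    x ℕ.+ (neg-part α ℕ.* A ℕ.+ pos-part β ℕ.* B) ≡ p ℕ.+ (pos-part α ℕ.* A ℕ.+ neg-part β ℕ.* B)
  balanced-difference x p α β A B e = ℤ.+-injective (begin
    + (x ℕ.+ (neg-part α ℕ.* A ℕ.+ pos-part β ℕ.* B))
      ≡⟨ pos-shifted-linear x (neg-part α) A (pos-part β) B ⟩
    + x + (+ neg-part α * + A + + pos-part β * + B)
      ≡⟨ shift-difference (+ x) (+ p) (+ pos-part α) (+ neg-part α) (+ pos-part β) (+ neg-part β) (+ A) (+ B)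
           (trans e (cong₂ (λ i j → i * + A - j * + B) (pos-neg-parts α) (pos-neg-parts β))) ⟩
    + p + (+ pos-part α * + A + + neg-part β * + B)
      ≡⟨ pos-shifted-linear p (pos-part α) A (neg-part β) B ⟨
    + (p ℕ.+ (pos-part α ℕ.* A ℕ.+ neg-part β ℕ.* B)) ∎)

  balanced-sum : ∀ t α β P Q → + t ≡ - (α * + P + β * + Q) →
    t ℕ.+ (pos-part α ℕ.* P ℕ.+ pos-part β ℕ.* Q) ≡ neg-part α ℕ.* P ℕ.+ neg-part β ℕ.* Q
  balanced-sum t α β P Q e = ℤ.+-injective (begin
    + (t ℕ.+ (pos-part α ℕ.* P ℕ.+ pos-part β ℕ.* Q))
      ≡⟨ pos-shifted-linear t (pos-part α) P (pos-part β) Q ⟩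
    + t + (+ pos-part α * + P + + pos-part β * + Q)
      ≡⟨ shift-sum (+ t) (+ pos-part α) (+ neg-part α) (+ pos-part β) (+ neg-part β) (+ P) (+ Q)
           (trans e (cong₂ (λ i j → - (i * + P + j * + Q)) (pos-neg-parts α) (pos-neg-parts β))) ⟩
    + neg-part α * + P + + neg-part β * + Q
      ≡⟨ pos-linear (neg-part α) P (neg-part β) Q ⟨
    + (neg-part α ℕ.* P ℕ.+ neg-part β ℕ.* Q) ∎)

  module Coordinates (a1 a2 a3 A B A' B' P Q : ℤ) .{{_ : ℤ.NonZero a3}}
    (hP : a3 * P ≡ a1 * A - a2 * A') (hQ : a3 * Q ≡ a2 * B' - a1 * B) (hdet : a3 ≡ A * B' - B * A') where

    module _ (u w : ℤ) (bezout : u * a1 + w * a2 ≡ 1ℤ) where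

      bezout-cancel : ∀ s t X → a3 * s ≡ a1 * X → a3 * t ≡ a2 * X → a3 * (u * s + w * t) ≡ X
      bezout-cancel s t X as at = begin
        a3 * (u * s + w * t)          ≡⟨ solve (a3 ∷ u ∷ s ∷ w ∷ t ∷ []) ⟩
        u * (a3 * s) + w * (a3 * t)   ≡⟨ cong₂ (λ p q → u * p + w * q) as at ⟩
        u * (a1 * X) + w * (a2 * X)   ≡⟨ solve (u ∷ a1 ∷ X ∷ w ∷ a2 ∷ []) ⟩
        (u * a1 + w * a2) * X         ≡⟨ cong (_* X) bezout ⟩
        1ℤ * X                        ≡⟨ ℤ.*-identityˡ X ⟩
        X ∎

      -- Cramer's rule with determinant a3 gives a3 α and a3 β; both become divisible by a3
      -- after multiplying by a1 or by a2, hence (Bézout) already before.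
      scaled-coordinates : ∀ y1 y2 z → a3 * z ≡ - (a1 * y1 + a2 * y2) →
        ∃₂ λ α β → a3 * α ≡ y1 * B' + y2 * B × a3 * β ≡ A * y2 + A' * y1
      scaled-coordinates y1 y2 z hz = _ , _ ,
        bezout-cancel (- (y2 * Q + z * B')) (y1 * Q - z * B) (y1 * B' + y2 * B)
          (begin
            a3 * - (y2 * Q + z * B')                                 ≡⟨ solve (a3 ∷ y2 ∷ Q ∷ z ∷ B' ∷ []) ⟩
            - (y2 * (a3 * Q) + B' * (a3 * z))                        ≡⟨ cong₂ (λ q c → - (y2 * q + B' * c)) hQ hz ⟩
            - (y2 * (a2 * B' - a1 * B) + B' * - (a1 * y1 + a2 * y2)) ≡⟨ solve (y2 ∷ a2 ∷ B' ∷ a1 ∷ B ∷ y1 ∷ []) ⟩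
            a1 * (y1 * B' + y2 * B) ∎)
          (begin
            a3 * (y1 * Q - z * B)                                    ≡⟨ solve (a3 ∷ y1 ∷ Q ∷ z ∷ B ∷ []) ⟩
            y1 * (a3 * Q) - B * (a3 * z)                             ≡⟨ cong₂ (λ q c → y1 * q - B * c) hQ hz ⟩
            y1 * (a2 * B' - a1 * B) - B * - (a1 * y1 + a2 * y2)      ≡⟨ solve (y1 ∷ a2 ∷ B' ∷ a1 ∷ B ∷ y2 ∷ []) ⟩
            a2 * (y1 * B' + y2 * B) ∎) ,
        bezout-cancel (y2 * P - z * A') (- (y1 * P + z * A)) (A * y2 + A' * y1)
          (begin
            a3 * (y2 * P - z * A')                                   ≡⟨ solve (a3 ∷ y2 ∷ P ∷ z ∷ A' ∷ []) ⟩
            y2 * (a3 * P) - A' * (a3 * z)                            ≡⟨ cong₂ (λ p c → y2 * p - A' * c) hP hz ⟩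
            y2 * (a1 * A - a2 * A') - A' * - (a1 * y1 + a2 * y2)     ≡⟨ solve (y2 ∷ a1 ∷ A ∷ a2 ∷ A' ∷ y1 ∷ []) ⟩
            a1 * (A * y2 + A' * y1) ∎)
          (begin
            a3 * - (y1 * P + z * A)                                  ≡⟨ solve (a3 ∷ y1 ∷ P ∷ z ∷ A ∷ []) ⟩
            - (y1 * (a3 * P) + A * (a3 * z))                         ≡⟨ cong₂ (λ p c → - (y1 * p + A * c)) hP hz ⟩
            - (y1 * (a1 * A - a2 * A') + A * - (a1 * y1 + a2 * y2))  ≡⟨ solve (y1 ∷ a1 ∷ A ∷ a2 ∷ A' ∷ y2 ∷ []) ⟩
            a2 * (A * y2 + A' * y1) ∎)

    unscale-coordinates : ∀ y1 y2 z α β → a3 * z ≡ - (a1 * y1 + a2 * y2) →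
      a3 * α ≡ y1 * B' + y2 * B → a3 * β ≡ A * y2 + A' * y1 →
      y1 ≡ α * A - β * B × y2 ≡ β * B' - α * A' × z ≡ - (α * P + β * Q)
    unscale-coordinates y1 y2 z α β hz a3α a3β = y1-eq , y2-eq , z-eq
      where
      y1-eq : y1 ≡ α * A - β * B
      y1-eq = ℤ.*-cancelˡ-≡ a3 y1 (α * A - β * B) (sym (begin
        a3 * (α * A - β * B)                              ≡⟨ solve (a3 ∷ α ∷ A ∷ β ∷ B ∷ []) ⟩
        A * (a3 * α) - B * (a3 * β)                       ≡⟨ cong₂ (λ p q → A * p - B * q) a3α a3β ⟩
        A * (y1 * B' + y2 * B) - B * (A * y2 + A' * y1)   ≡⟨ solve (A ∷ y1 ∷ B' ∷ y2 ∷ B ∷ A' ∷ []) ⟩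
        (A * B' - B * A') * y1                            ≡⟨ cong (_* y1) hdet ⟨
        a3 * y1 ∎))

      y2-eq : y2 ≡ β * B' - α * A'
      y2-eq = ℤ.*-cancelˡ-≡ a3 y2 (β * B' - α * A') (sym (begin
        a3 * (β * B' - α * A')                            ≡⟨ solve (a3 ∷ β ∷ B' ∷ α ∷ A' ∷ []) ⟩
        B' * (a3 * β) - A' * (a3 * α)                     ≡⟨ cong₂ (λ p q → B' * p - A' * q) a3β a3α ⟩
        B' * (A * y2 + A' * y1) - A' * (y1 * B' + y2 * B) ≡⟨ solve (B' ∷ A ∷ y2 ∷ A' ∷ y1 ∷ B ∷ []) ⟩
        (A * B' - B * A') * y2                            ≡⟨ cong (_* y2) hdet ⟨
        a3 * y2 ∎))

      z-eq : z ≡ - (α * P + β * Q)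
      z-eq = ℤ.*-cancelˡ-≡ a3 z (- (α * P + β * Q)) (begin
        a3 * z                                              ≡⟨ hz ⟩
        - (a1 * y1 + a2 * y2)                               ≡⟨ cong₂ (λ p q → - (a1 * p + a2 * q)) y1-eq y2-eq ⟩
        - (a1 * (α * A - β * B) + a2 * (β * B' - α * A'))   ≡⟨ solve (a1 ∷ α ∷ A ∷ β ∷ B ∷ a2 ∷ B' ∷ A' ∷ []) ⟩
        - (α * (a1 * A - a2 * A') + β * (a2 * B' - a1 * B)) ≡⟨ cong₂ (λ p q → - (α * p + β * q)) hP hQ ⟨
        - (α * (a3 * P) + β * (a3 * Q))                     ≡⟨ solve (α ∷ a3 ∷ P ∷ β ∷ Q ∷ []) ⟩
        a3 * - (α * P + β * Q) ∎)

    coordinates : ∀ u w → u * a1 + w * a2 ≡ 1ℤ → ∀ y1 y2 z → a3 * z ≡ - (a1 * y1 + a2 * y2) →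
      ∃₂ λ α β → y1 ≡ α * A - β * B × y2 ≡ β * B' - α * A' × z ≡ - (α * P + β * Q)
    coordinates u w bezout y1 y2 z hz =
      let α , β , a3α , a3β = scaled-coordinates u w bezout y1 y2 z hz
      in α , β , unscale-coordinates y1 y2 z α β hz a3α a3β

  -- (x1 - p1, x2 - p2, t) = α (A, -A', -P) + β (-B, B', -Q), with each coordinate equation
  -- rearranged so that both sides are natural numbers.
  lattice-coordinates : ∀ (a1 a2 a3 A B A' B' P Q : ℕ) .{{_ : NonZero a3}} →
    a1 ℕ.* A ≡ a2 ℕ.* A' ℕ.+ a3 ℕ.* P → a2 ℕ.* B' ≡ a1 ℕ.* B ℕ.+ a3 ℕ.* Q → A ℕ.* B' ≡ a3 ℕ.+ B ℕ.* A' →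
    Bézout.Identity 1 a1 a2 →
    ∀ x1 x2 t p1 p2 → a1 ℕ.* x1 ℕ.+ a2 ℕ.* x2 ℕ.+ a3 ℕ.* t ≡ a1 ℕ.* p1 ℕ.+ a2 ℕ.* p2 →
    ∃₂ λ α β → x1 ℕ.+ (neg-part α ℕ.* A ℕ.+ pos-part β ℕ.* B) ≡ p1 ℕ.+ (pos-part α ℕ.* A ℕ.+ neg-part β ℕ.* B)
             × x2 ℕ.+ (neg-part β ℕ.* B' ℕ.+ pos-part α ℕ.* A') ≡ p2 ℕ.+ (pos-part β ℕ.* B' ℕ.+ neg-part α ℕ.* A')
             × t ℕ.+ (pos-part α ℕ.* P ℕ.+ pos-part β ℕ.* Q) ≡ neg-part α ℕ.* P ℕ.+ neg-part β ℕ.* Q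
  lattice-coordinates a1 a2 a3 A B A' B' P Q P-eq Q-eq det coprime x1 x2 t p1 p2 e =
    let u , w , bezout = bezout-ℤ coprime
        α , β , e1 , e2 , e3 = coordinates u w bezout (+ x1 - + p1) (+ x2 - + p2) (+ t)
          (displacement (+ a1) (+ a2) (+ a3) (+ x1) (+ x2) (+ t) (+ p1) (+ p2) (cast-linear a1 x1 a2 x2 a3 t p1 p2 e))
    in α , β , balanced-difference x1 p1 α β A B e1 , balanced-difference x2 p2 β α B' A' e2 , balanced-sum t α β P Q e3
    where
    open Coordinates (+ a1) (+ a2) (+ a3) (+ A) (+ B) (+ A') (+ B') (+ P) (+ Q)
      (isolate (+ a1 * + A) (+ a2 * + A') (+ a3 * + P) (cast-product≡sum a1 A a2 A' a3 P P-eq))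
      (isolate (+ a2 * + B') (+ a1 * + B) (+ a3 * + Q) (cast-product≡sum a2 B' a1 B a3 Q Q-eq))
      (isolate (+ A * + B') (+ B * + A') (+ a3) (trans (cast-product≡shift A B' a3 B A' det) (ℤ.+-comm (+ a3) (+ B * + A'))))

open Lattice using (pos-part; neg-part; lattice-coordinates)

open import Data.Nat using (ℕ; zero; suc; _+_; _*_; _∸_; _<_; _≤_; _⊓_; z≤n; s≤s; z<s; NonZero; >-nonZero; >-nonZero⁻¹; _≤?_; _<?_)
open import Data.Nat.Properties
open import Data.Nat.DivMod using (_%_; _/_; m≡m%n+[m/n]*n; m%n≡m∸m/n*n; m%n<n; m/n*n≤m; m≥n⇒m/n>0)
open import Data.Nat.Induction using (<-wellFounded)
open import Data.Nat.Tactic.RingSolver using (solve)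
open import Induction.WellFounded using (Acc; acc)
import Data.Integer as ℤ
import Data.Integer.Properties as ℤ
open import Data.Sum as Sum using (_⊎_; inj₁; inj₂; [_,_])
open import Data.Empty using (⊥; ⊥-elim)
open import Function using (_∘_)
open import Relation.Binary using (tri<; tri≈; tri>)
open import Relation.Nullary using (¬_; yes; no)

value-congruent : ∀ {a1 a2} → Bézout.Identity 1 a1 a2 → ∀ n m .{{_ : NonZero m}} →
                  ∃₂ λ x1 x2 → ∃ λ k → a1 * x1 + a2 * x2 ≡ n + m * k
value-congruent {a1} {a2} (Bézout.+- x y eq) n (suc c) = n * x , n * y * c , n * y * a2 , (begin
  a1 * (n * x) + a2 * (n * y * c)     ≡⟨ solve (a1 ∷ n ∷ x ∷ a2 ∷ y ∷ c ∷ []) ⟩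
  n * (x * a1) + a2 * (n * y * c)     ≡⟨ cong (λ v → n * v + a2 * (n * y * c)) eq ⟨
  n * (1 + y * a2) + a2 * (n * y * c)  ≡⟨ solve (n ∷ y ∷ a2 ∷ c ∷ []) ⟩
  n + suc c * (n * y * a2) ∎)
  where open ≡-Reasoning
value-congruent {a1} {a2} (Bézout.-+ x y eq) n (suc c) = n * x * c , n * y , n * x * a1 , (begin
  a1 * (n * x * c) + a2 * (n * y)      ≡⟨ solve (a1 ∷ n ∷ x ∷ c ∷ a2 ∷ y ∷ []) ⟩
  a1 * (n * x * c) + n * (y * a2)      ≡⟨ cong (λ v → a1 * (n * x * c) + n * v) eq ⟨
  a1 * (n * x * c) + n * (1 + x * a1)  ≡⟨ solve (a1 ∷ n ∷ x ∷ c ∷ []) ⟩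
  n + suc c * (n * x * a1) ∎)
  where open ≡-Reasoning

excess-multiple : ∀ {m n} c j k → m + c * j ≡ n + c * k → m < n → ∃ λ i → n ≡ m + c * suc i
excess-multiple {m} {n} c j k e m<n with k <? j
... | no k≮j = ⊥-elim (<⇒≢ (begin-strict
  m + c * j ≤⟨ +-monoʳ-≤ m (*-monoʳ-≤ c (≮⇒≥ k≮j)) ⟩
  m + c * k <⟨ +-monoˡ-< (c * k) m<n ⟩
  n + c * k ∎) e)
  where open ≤-Reasoning
... | yes k<j with m≤n⇒∃[o]m+o≡n k<j
...   | i , refl = i , +-cancelʳ-≡ (c * k) n (m + c * suc i)
                         (trans (sym e) (solve (m ∷ c ∷ k ∷ i ∷ [])))

multiple-summand-≤ : ∀ x a A z p → x + (suc a * A + z) ≡ p + 0 → A ≤ p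
multiple-summand-≤ x a A z p e = begin
  A                   ≤⟨ m≤m+n A (a * A) ⟩
  suc a * A           ≤⟨ m≤m+n (suc a * A) z ⟩
  suc a * A + z       ≤⟨ m≤n+m (suc a * A + z) x ⟩
  x + (suc a * A + z) ≡⟨ e ⟩
  p + 0               ≡⟨ +-identityʳ p ⟩
  p ∎
  where open ≤-Reasoning

zero-coefficient : ∀ x p a b A → x + suc a * A ≡ p + suc b * 0 → A ≤ p
zero-coefficient x p a b A e = begin
  A             ≤⟨ m≤m+n A (a * A) ⟩
  suc a * A     ≤⟨ m≤n+m (suc a * A) x ⟩
  x + suc a * A ≡⟨ e ⟩
  p + suc b * 0 ≡⟨ cong (p +_) (*-zeroʳ (suc b)) ⟩
  p + 0         ≡⟨ +-identityʳ p ⟩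
  p ∎
  where open ≤-Reasoning

coefficient-gap : ∀ x p a b A B → x + suc a * A ≡ p + suc b * B → B ≤ A → b < a → A ≤ p
coefficient-gap x p a b A B e B≤A b<a = +-cancelʳ-≤ (a * A) A p (begin
  A + a * A     ≤⟨ m≤n+m (suc a * A) x ⟩
  x + suc a * A ≡⟨ e ⟩
  p + suc b * B ≤⟨ +-monoʳ-≤ p (*-mono-≤ b<a B≤A) ⟩
  p + a * A ∎)
  where open ≤-Reasoning

equal-coefficients : ∀ x p a A B → x + suc a * A ≡ p + suc a * B → B ≤ A → A ∸ B ≤ p
equal-coefficients x p a A B e B≤A = ≤-trans (m≤m+n (A ∸ B) (a * (A ∸ B))) (+-cancelʳ-≤ (suc a * B) (suc a * (A ∸ B)) p (begin
  suc a * (A ∸ B) + suc a * B ≡⟨ *-distribˡ-+ (suc a) (A ∸ B) B ⟨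
  suc a * (A ∸ B + B)         ≡⟨ cong (suc a *_) (m∸n+n≡m B≤A) ⟩
  suc a * A                   ≤⟨ m≤n+m (suc a * A) x ⟩
  x + suc a * A               ≡⟨ e ⟩
  p + suc a * B ∎))
  where open ≤-Reasoning

m+c*d≡n⇒m<n : ∀ m c d {n} → 0 < c → 0 < d → m + c * d ≡ n → m < n
m+c*d≡n⇒m<n m c d c>0 d>0 e = begin-strict
  m         <⟨ m<m+n m (*-mono-≤ c>0 d>0) ⟩
  m + c * d ≡⟨ e ⟩
  _ ∎
  where open ≤-Reasoning

x<m∸n⇒n<m : ∀ {x m n} → x < m ∸ n → n < m
x<m∸n⇒n<m {x} h = m∸n≢0⇒n<m (λ m∸n≡0 → n≮0 (subst (x <_) m∸n≡0 h))

positive-factors : ∀ m n → 0 < m * n → 0 < m × 0 < n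
positive-factors m n h =
  >-nonZero⁻¹ m {{m*n≢0⇒m≢0 m {{>-nonZero h}}}} , >-nonZero⁻¹ n {{m*n≢0⇒n≢0 m {{>-nonZero h}}}}

m∸n≤o⇒m≤o+n : ∀ {m n o} → m ∸ n ≤ o → m ≤ o + n
m∸n≤o⇒m≤o+n {m} {n} {o} h = ≤-trans (m≤n+m∸n m n) (≤-trans (+-monoʳ-≤ n h) (≤-reflexive (+-comm n o)))

positive-suc : ∀ {n} → 0 < n → ∃ λ m → suc m ≡ n
positive-suc {suc m} _ = m , refl

LShaped : State → Set
LShaped s = (b s ≤ bPrev s × b'Prev s ≤ b' s) ⊎ b s ≡ 0

crossing-impossible : ∀ {A B A' B'} x1 x2 p1 p2 a b → LShaped (st A B A' B') →
  x1 + suc a * A ≡ p1 + suc b * B → x2 + suc b * B' ≡ p2 + suc a * A' →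
  p1 < A → p2 < B' → p1 < A ∸ B ⊎ p2 < B' ∸ A' → ⊥
crossing-impossible {A} x1 x2 p1 p2 a b (inj₂ B≡0) e1 _ p1<A _ _ =
  <⇒≱ p1<A (zero-coefficient x1 p1 a b A (subst (λ B → x1 + suc a * A ≡ p1 + suc b * B) B≡0 e1))
crossing-impossible {A} {B} {A'} {B'} x1 x2 p1 p2 a b (inj₁ (B≤A , A'≤B')) e1 e2 p1<A p2<B' thin with <-cmp a b
... | tri< a<b _ _ = <⇒≱ p2<B' (coefficient-gap x2 p2 b a B' A' e2 A'≤B' a<b)
... | tri> _ _ b<a = <⇒≱ p1<A (coefficient-gap x1 p1 a b A B e1 B≤A b<a)
... | tri≈ _ refl _ =
  [ (λ p1<A∸B → <⇒≱ p1<A∸B (equal-coefficients x1 p1 a A B e1 B≤A))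
  , (λ p2<B'∸A' → <⇒≱ p2<B'∸A' (equal-coefficients x2 p2 a B' A' e2 A'≤B'))
  ] thin

module Frobenius (a1 a2 a3 A B A' B' P Q : ℕ) .{{_ : NonZero a3}} (coprime : Bézout.Identity 1 a1 a2)
  (P-eq : a1 * A ≡ a2 * A' + a3 * P) (Q-eq : a2 * B' ≡ a1 * B + a3 * Q) (det : A * B' ≡ a3 + B * A')
  (P-pos : 1 ≤ P) (Q-pos : 1 ≤ Q) (shape : LShaped (st A B A' B')) where

  value : ℕ → ℕ → ℕ
  value x1 x2 = a1 * x1 + a2 * x2

  InRegion : ℕ → ℕ → Set
  InRegion x1 x2 = x1 < A × x2 < B' × (x1 < A ∸ B ⊎ x2 < B' ∸ A')

  signs-impossible : ∀ {p1 p2} → InRegion p1 p2 → ∀ x1 x2 t α β →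
    x1 + (neg-part α * A + pos-part β * B) ≡ p1 + (pos-part α * A + neg-part β * B) →
    x2 + (neg-part β * B' + pos-part α * A') ≡ p2 + (pos-part β * B' + neg-part α * A') →
    suc t + (pos-part α * P + pos-part β * Q) ≡ neg-part α * P + neg-part β * Q → ⊥
  signs-impossible _ x1 x2 t (ℤ.+ a) (ℤ.+ b) _ _ ()
  signs-impossible {p2 = p2} (_ , p2<B' , _) x1 x2 t (ℤ.+ a) ℤ.-[1+ b ] _ e2 _ =
    <⇒≱ p2<B' (multiple-summand-≤ x2 b B' (a * A') p2 e2)
  signs-impossible {p1} (p1<A , _ , _) x1 x2 t ℤ.-[1+ a ] (ℤ.+ b) e1 _ _ =
    <⇒≱ p1<A (multiple-summand-≤ x1 a A (b * B) p1 e1)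
  signs-impossible {p1} {p2} (p1<A , p2<B' , thin) x1 x2 t ℤ.-[1+ a ] ℤ.-[1+ b ] e1 e2 _ =
    crossing-impossible x1 x2 p1 p2 a b shape
      (trans (cong (x1 +_) (sym (+-identityʳ (suc a * A)))) e1)
      (trans (cong (x2 +_) (sym (+-identityʳ (suc b * B')))) e2)
      p1<A p2<B' thin

  region-unrepresentable : ∀ {p1 p2} → InRegion p1 p2 → ∀ x1 x2 t → value x1 x2 + a3 * suc t ≢ value p1 p2
  region-unrepresentable {p1} {p2} region x1 x2 t e =
    let α , β , e1 , e2 , e3 = lattice-coordinates a1 a2 a3 A B A' B' P Q P-eq Q-eq det coprime x1 x2 (suc t) p1 p2 e
    in signs-impossible region x1 x2 t α β e1 e2 e3

  value-suc : ∀ x1 x2 → value (suc x1) (suc x2) ≡ value x1 x2 + (a1 + a2)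
  value-suc x1 x2 = begin
    a1 * suc x1 + a2 * suc x2      ≡⟨ solve (a1 ∷ a2 ∷ x1 ∷ x2 ∷ []) ⟩
    a1 * x1 + a2 * x2 + (a1 + a2)  ∎
    where open ≡-Reasoning

  move-P : ∀ y1 y2 → value y1 (y2 + A') + a3 * P ≡ value (y1 + A) y2
  move-P y1 y2 = begin
    a1 * y1 + a2 * (y2 + A') + a3 * P       ≡⟨ solve (a1 ∷ a2 ∷ a3 ∷ y1 ∷ y2 ∷ A' ∷ P ∷ []) ⟩
    a1 * y1 + a2 * y2 + (a2 * A' + a3 * P)  ≡⟨ cong (value y1 y2 +_) P-eq ⟨
    a1 * y1 + a2 * y2 + a1 * A              ≡⟨ solve (a1 ∷ a2 ∷ y1 ∷ y2 ∷ A ∷ []) ⟩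
    a1 * (y1 + A) + a2 * y2                 ∎
    where open ≡-Reasoning

  move-Q : ∀ y1 y2 → value (y1 + B) y2 + a3 * Q ≡ value y1 (y2 + B')
  move-Q y1 y2 = begin
    a1 * (y1 + B) + a2 * y2 + a3 * Q        ≡⟨ solve (a1 ∷ a2 ∷ a3 ∷ y1 ∷ y2 ∷ B ∷ Q ∷ []) ⟩
    a1 * y1 + a2 * y2 + (a1 * B + a3 * Q)   ≡⟨ cong (value y1 y2 +_) Q-eq ⟨
    a1 * y1 + a2 * y2 + a2 * B'             ≡⟨ solve (a1 ∷ a2 ∷ y1 ∷ y2 ∷ B' ∷ []) ⟩
    a1 * y1 + a2 * (y2 + B')                ∎
    where open ≡-Reasoning

  move-PQ : ∀ y1 y2 → value y1 y2 + a3 * (P + Q) + value B A' ≡ value (y1 + A) (y2 + B')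
  move-PQ y1 y2 = begin
    a1 * y1 + a2 * y2 + a3 * (P + Q) + (a1 * B + a2 * A')      ≡⟨ solve (a1 ∷ a2 ∷ a3 ∷ y1 ∷ y2 ∷ B ∷ A' ∷ P ∷ Q ∷ []) ⟩
    a1 * y1 + a2 * y2 + (a2 * A' + a3 * P) + (a1 * B + a3 * Q) ≡⟨ cong₂ (λ u v → value y1 y2 + u + v) P-eq Q-eq ⟨
    a1 * y1 + a2 * y2 + a1 * A + a2 * B'                       ≡⟨ solve (a1 ∷ a2 ∷ y1 ∷ y2 ∷ A ∷ B' ∷ []) ⟩
    a1 * (y1 + A) + a2 * (y2 + B')                             ∎
    where open ≡-Reasoning

  Descent : ℕ → ℕ → Set
  Descent x1 x2 = ∃₂ λ y1 y2 → ∃ λ d → 1 ≤ d × value y1 y2 + a3 * d ≡ value x1 x2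

  region-or-descent : ∀ x1 x2 → InRegion x1 x2 ⊎ Descent x1 x2
  region-or-descent x1 x2 with A ≤? x1 | B' ≤? x2
  ... | yes A≤x1 | _ = inj₂ (x1 ∸ A , x2 + A' , P , P-pos ,
          trans (move-P (x1 ∸ A) x2) (cong (λ z → value z x2) (m∸n+n≡m A≤x1)))
  ... | no _ | yes B'≤x2 = inj₂ (x1 + B , x2 ∸ B' , Q , Q-pos ,
          trans (move-Q x1 (x2 ∸ B')) (cong (value x1) (m∸n+n≡m B'≤x2)))
  ... | no A≰x1 | no B'≰x2 with A ∸ B ≤? x1 | B' ∸ A' ≤? x2
  ...   | no thin | _ = inj₁ (≰⇒> A≰x1 , ≰⇒> B'≰x2 , inj₁ (≰⇒> thin))
  ...   | yes _ | no thin = inj₁ (≰⇒> A≰x1 , ≰⇒> B'≰x2 , inj₂ (≰⇒> thin))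
  ...   | yes A∸B≤x1 | yes B'∸A'≤x2 = inj₂ (x1 + B ∸ A , x2 + A' ∸ B' , P + Q , ≤-trans P-pos (m≤m+n P Q) ,
          +-cancelʳ-≡ (value B A') _ _ (begin
            value (x1 + B ∸ A) (x2 + A' ∸ B') + a3 * (P + Q) + value B A' ≡⟨ move-PQ (x1 + B ∸ A) (x2 + A' ∸ B') ⟩
            value (x1 + B ∸ A + A) (x2 + A' ∸ B' + B')                     ≡⟨ cong₂ value (m∸n+n≡m (m∸n≤o⇒m≤o+n A∸B≤x1)) (m∸n+n≡m (m∸n≤o⇒m≤o+n B'∸A'≤x2)) ⟩
            a1 * (x1 + B) + a2 * (x2 + A')                                  ≡⟨ solve (a1 ∷ a2 ∷ x1 ∷ x2 ∷ B ∷ A' ∷ []) ⟩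
            a1 * x1 + a2 * x2 + (a1 * B + a2 * A') ∎))
    where open ≡-Reasoning

  reduce : ∀ x1 x2 → ∃₂ λ r1 r2 → ∃ λ j → InRegion r1 r2 × value r1 r2 + a3 * j ≡ value x1 x2
  reduce x1 x2 = go x1 x2 (<-wellFounded (value x1 x2))
    where
    go : ∀ x1 x2 → Acc _<_ (value x1 x2) → ∃₂ λ r1 r2 → ∃ λ j → InRegion r1 r2 × value r1 r2 + a3 * j ≡ value x1 x2
    go x1 x2 (acc smaller) with region-or-descent x1 x2
    ... | inj₁ region = x1 , x2 , 0 , region , trans (cong (value x1 x2 +_) (*-zeroʳ a3)) (+-identityʳ _)
    ... | inj₂ (y1 , y2 , d , d≥1 , e) with go y1 y2 (smaller (m+c*d≡n⇒m<n (value y1 y2) a3 d (>-nonZero⁻¹ a3) d≥1 e))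
    ...   | r1 , r2 , j , region , e' = r1 , r2 , j + d , region , (begin
      a1 * r1 + a2 * r2 + a3 * (j + d)      ≡⟨ solve (a1 ∷ a2 ∷ a3 ∷ r1 ∷ r2 ∷ j ∷ d ∷ []) ⟩
      a1 * r1 + a2 * r2 + a3 * j + a3 * d   ≡⟨ cong (_+ a3 * d) e' ⟩
      value y1 y2 + a3 * d                  ≡⟨ e ⟩
      value x1 x2                           ∎)
      where open ≡-Reasoning

  G : ℕ
  G = (A * a1 + B' * a2) ∸ ((B * a1) ⊓ (A' * a2))

  corner-value-A : B ≤ A → value (A ∸ B) B' ≡ (A * a1 + B' * a2) ∸ B * a1
  corner-value-A B≤A = begin
    a1 * (A ∸ B) + a2 * B'          ≡⟨ cong₂ _+_ (*-distribˡ-∸ a1 A B) (*-comm a2 B') ⟩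
    (a1 * A ∸ a1 * B) + B' * a2     ≡⟨ cong₂ (λ u v → u ∸ v + B' * a2) (*-comm a1 A) (*-comm a1 B) ⟩
    (A * a1 ∸ B * a1) + B' * a2     ≡⟨ +-∸-comm (B' * a2) (*-monoˡ-≤ a1 B≤A) ⟨
    (A * a1 + B' * a2) ∸ B * a1 ∎
    where open ≡-Reasoning

  corner-value-B' : A' ≤ B' → value A (B' ∸ A') ≡ (A * a1 + B' * a2) ∸ A' * a2
  corner-value-B' A'≤B' = begin
    a1 * A + a2 * (B' ∸ A')         ≡⟨ cong₂ _+_ (*-comm a1 A) (*-distribˡ-∸ a2 B' A') ⟩
    A * a1 + (a2 * B' ∸ a2 * A')    ≡⟨ cong₂ (λ u v → A * a1 + (u ∸ v)) (*-comm a2 B') (*-comm a2 A') ⟩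
    A * a1 + (B' * a2 ∸ A' * a2)    ≡⟨ +-∸-assoc (A * a1) (*-monoˡ-≤ a2 A'≤B') ⟨
    (A * a1 + B' * a2) ∸ A' * a2 ∎
    where open ≡-Reasoning

  region-bound : ∀ {r1 r2} → InRegion r1 r2 → value (suc r1) (suc r2) ≤ G
  region-bound {r1} {r2} (_ , r2<B' , inj₁ r1<A∸B) = begin
    value (suc r1) (suc r2)         ≤⟨ +-mono-≤ (*-monoʳ-≤ a1 r1<A∸B) (*-monoʳ-≤ a2 r2<B') ⟩
    value (A ∸ B) B'                ≡⟨ corner-value-A (<⇒≤ (x<m∸n⇒n<m r1<A∸B)) ⟩
    (A * a1 + B' * a2) ∸ B * a1     ≤⟨ ∸-monoʳ-≤ (A * a1 + B' * a2) (m⊓n≤m (B * a1) (A' * a2)) ⟩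
    G ∎
    where open ≤-Reasoning
  region-bound {r1} {r2} (r1<A , _ , inj₂ r2<B'∸A') = begin
    value (suc r1) (suc r2)         ≤⟨ +-mono-≤ (*-monoʳ-≤ a1 r1<A) (*-monoʳ-≤ a2 r2<B'∸A') ⟩
    value A (B' ∸ A')               ≡⟨ corner-value-B' (<⇒≤ (x<m∸n⇒n<m r2<B'∸A')) ⟩
    (A * a1 + B' * a2) ∸ A' * a2    ≤⟨ ∸-monoʳ-≤ (A * a1 + B' * a2) (m⊓n≤n (B * a1) (A' * a2)) ⟩
    G ∎
    where open ≤-Reasoning

  positive-sides : 0 < A × 0 < B'
  positive-sides = positive-factors A B' (subst (0 <_) (sym det) (<-≤-trans (>-nonZero⁻¹ a3) (m≤m+n a3 (B * A'))))

  B<A : B * a1 ≤ A' * a2 → B < A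
  B<A Ba1≤A'a2 = *-cancelˡ-< a1 B A (begin-strict
    a1 * B           ≡⟨ *-comm a1 B ⟩
    B * a1           ≤⟨ Ba1≤A'a2 ⟩
    A' * a2          ≡⟨ *-comm A' a2 ⟩
    a2 * A'          <⟨ m<m+n (a2 * A') (*-mono-≤ (>-nonZero⁻¹ a3) P-pos) ⟩
    a2 * A' + a3 * P ≡⟨ P-eq ⟨
    a1 * A ∎)
    where open ≤-Reasoning

  A'<B' : A' * a2 < B * a1 → A' < B'
  A'<B' A'a2<Ba1 = *-cancelʳ-< a2 A' B' (begin-strict
    A' * a2          <⟨ A'a2<Ba1 ⟩
    B * a1           ≡⟨ *-comm B a1 ⟩
    a1 * B           ≤⟨ m≤m+n (a1 * B) (a3 * Q) ⟩
    a1 * B + a3 * Q  ≡⟨ Q-eq ⟨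
    a2 * B'          ≡⟨ *-comm a2 B' ⟩
    B' * a2 ∎)
    where open ≤-Reasoning

  Corner : Set
  Corner = ∃₂ λ p1 p2 → InRegion p1 p2 × value (suc p1) (suc p2) ≡ G

  corner₁ : B * a1 ≤ A' * a2 → Corner
  corner₁ le with positive-suc (m<n⇒0<n∸m (B<A le)) | positive-suc (proj₂ positive-sides)
  ... | d , sd≡A∸B | e , se≡B' =
    d , e , (≤-trans (≤-reflexive sd≡A∸B) (m∸n≤m A B) , ≤-reflexive se≡B' , inj₁ (≤-reflexive sd≡A∸B)) , (begin
      value (suc d) (suc e)        ≡⟨ cong₂ value sd≡A∸B se≡B' ⟩
      value (A ∸ B) B'             ≡⟨ corner-value-A (<⇒≤ (B<A le)) ⟩
      (A * a1 + B' * a2) ∸ B * a1  ≡⟨ cong ((A * a1 + B' * a2) ∸_) (m≤n⇒m⊓n≡m le) ⟨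
      G ∎)
    where open ≡-Reasoning

  corner₂ : A' * a2 < B * a1 → Corner
  corner₂ lt with positive-suc (proj₁ positive-sides) | positive-suc (m<n⇒0<n∸m (A'<B' lt))
  ... | d , sd≡A | e , se≡B'∸A' =
    d , e , (≤-reflexive sd≡A , ≤-trans (≤-reflexive se≡B'∸A') (m∸n≤m B' A') , inj₂ (≤-reflexive se≡B'∸A')) , (begin
      value (suc d) (suc e)         ≡⟨ cong₂ value sd≡A se≡B'∸A' ⟩
      value A (B' ∸ A')             ≡⟨ corner-value-B' (<⇒≤ (A'<B' lt)) ⟩
      (A * a1 + B' * a2) ∸ A' * a2  ≡⟨ cong ((A * a1 + B' * a2) ∸_) (m≥n⇒m⊓n≡n (<⇒≤ lt)) ⟨
      G ∎)
    where open ≡-Reasoning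

  corner : Corner
  corner with B * a1 ≤? A' * a2
  ... | yes le = corner₁ le
  ... | no nle = corner₂ (≰⇒> nle)

  evenFormula≡G : evenFormula a1 a2 (st A B A' B') ≡ ℤ.+ G
  evenFormula≡G = trans (ℤ.m-n≡m⊖n (A * a1 + B' * a2) ((B * a1) ⊓ (A' * a2))) (ℤ.⊖-≥ min≤sum)
    where
    open ≤-Reasoning
    min≤sum : (B * a1) ⊓ (A' * a2) ≤ A * a1 + B' * a2
    min≤sum = begin
      (B * a1) ⊓ (A' * a2)  ≤⟨ m⊓n≤m (B * a1) (A' * a2) ⟩
      B * a1                ≡⟨ *-comm B a1 ⟩
      a1 * B                ≤⟨ m≤m+n (a1 * B) (a3 * Q) ⟩
      a1 * B + a3 * Q       ≡⟨ Q-eq ⟨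
      a2 * B'               ≡⟨ *-comm a2 B' ⟩
      B' * a2               ≤⟨ m≤n+m (B' * a2) (A * a1) ⟩
      A * a1 + B' * a2      ∎

  G-unrepresentable : ¬ RepPos a1 a2 a3 (ℤ.+ G)
  G-unrepresentable (y1 , y2 , y3 , e) with corner
  ... | p1 , p2 , region , value≡G = region-unrepresentable region y1 y2 y3 (+-cancelʳ-≡ (a1 + a2) _ _ (begin
    a1 * y1 + a2 * y2 + a3 * suc y3 + (a1 + a2)  ≡⟨ solve (a1 ∷ a2 ∷ a3 ∷ y1 ∷ y2 ∷ y3 ∷ []) ⟩
    a1 * suc y1 + a2 * suc y2 + a3 * suc y3      ≡⟨ ℤ.+-injective e ⟨
    G                                            ≡⟨ value≡G ⟨
    value (suc p1) (suc p2)                      ≡⟨ value-suc p1 p2 ⟩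
    value p1 p2 + (a1 + a2)                      ∎))
    where open ≡-Reasoning

  a1+a2≤G : a1 + a2 ≤ G
  a1+a2≤G with corner
  ... | p1 , p2 , _ , value≡G = begin
    a1 + a2                  ≤⟨ m≤n+m (a1 + a2) (value p1 p2) ⟩
    value p1 p2 + (a1 + a2)  ≡⟨ value-suc p1 p2 ⟨
    value (suc p1) (suc p2)  ≡⟨ value≡G ⟩
    G ∎
    where open ≤-Reasoning

  region-value-< : ∀ {r1 r2 n} → InRegion r1 r2 → G < a1 + a2 + n → value r1 r2 < n
  region-value-< {r1} {r2} {n} region G<N = +-cancelˡ-< (a1 + a2) (value r1 r2) n (begin-strict
    a1 + a2 + value r1 r2   ≡⟨ +-comm (a1 + a2) (value r1 r2) ⟩
    value r1 r2 + (a1 + a2) ≡⟨ value-suc r1 r2 ⟨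
    value (suc r1) (suc r2) ≤⟨ region-bound region ⟩
    G                       <⟨ G<N ⟩
    a1 + a2 + n ∎)
    where open ≤-Reasoning

  representable-shifted : ∀ n → G < a1 + a2 + n → RepPos a1 a2 a3 (ℤ.+ (a1 + a2 + n))
  representable-shifted n G<N with value-congruent coprime n a3
  ... | x1 , x2 , k , x≡n+a3k with reduce x1 x2
  ... | r1 , r2 , j , region , r≡x with excess-multiple a3 j k (trans r≡x x≡n+a3k) (region-value-< region G<N)
  ... | i , n≡r+a3i = r1 , r2 , i , cong ℤ.+_ (begin
    a1 + a2 + n                                  ≡⟨ cong (a1 + a2 +_) n≡r+a3i ⟩
    a1 + a2 + (a1 * r1 + a2 * r2 + a3 * suc i)   ≡⟨ solve (a1 ∷ a2 ∷ a3 ∷ r1 ∷ r2 ∷ i ∷ []) ⟩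
    a1 * suc r1 + a2 * suc r2 + a3 * suc i       ∎)
    where open ≡-Reasoning

  representable-above : ∀ n → ℤ.+ G ℤ.< n → RepPos a1 a2 a3 n
  representable-above (ℤ.+ N) (ℤ.+<+ G<N) with m≤n⇒∃[o]m+o≡n (≤-trans a1+a2≤G (<⇒≤ G<N))
  ... | n , refl = representable-shifted n G<N

  frobenius-number : IsG a1 a2 a3 (evenFormula a1 a2 (st A B A' B'))
  frobenius-number = subst (IsG a1 a2 a3) (sym evenFormula≡G) (G-unrepresentable , representable-above)

-- For s = st A B A' B' the vectors (A, -A', -P) and (-B, B', -Q) satisfy a1 x1 + a2 x2 + a3 x3 = 0,
-- and det says that they span all such vectors.
record LatticeBasis (a1 a2 a3 : ℕ) (s : State) : Set where
  field
    P Q  : ℕ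
    P-eq : a1 * bPrev s ≡ a2 * b'Prev s + a3 * P
    Q-eq : a2 * b' s ≡ a1 * b s + a3 * Q
    det  : bPrev s * b' s ≡ a3 + b s * b'Prev s
open LatticeBasis

Positive : ∀ {a1 a2 a3 s} → LatticeBasis a1 a2 a3 s → Set
Positive β = 1 ≤ P β × 1 ≤ Q β

frobenius-of-basis : ∀ {a1 a2 a3 s} .{{_ : NonZero a3}} → Bézout.Identity 1 a1 a2 →
  (β : LatticeBasis a1 a2 a3 s) → Positive β → LShaped s → IsG a1 a2 a3 (evenFormula a1 a2 s)
frobenius-of-basis {a1} {a2} {a3} {s} coprime β (P-pos , Q-pos) shape =
  Frobenius.frobenius-number a1 a2 a3 (bPrev s) (b s) (b'Prev s) (b' s) (P β) (Q β) coprime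
    (P-eq β) (Q-eq β) (det β) P-pos Q-pos shape

basis-step : ∀ {a1 a2 a3 A B A' B'} m X Y → X + m * B ≡ A → Y + m * B' ≡ A' →
  LatticeBasis a1 a2 a3 (st A B A' B') → LatticeBasis a2 a1 a3 (st B' Y B X)
basis-step {a1} {a2} {a3} {A} {B} {A'} {B'} m X Y hX hY
  record { P = P ; Q = Q ; P-eq = P-eq ; Q-eq = Q-eq ; det = det } = record
  { P = Q
  ; Q = P + m * Q
  ; P-eq = Q-eq
  ; Q-eq = +-cancelʳ-≡ (m * (a1 * B)) (a1 * X) (a2 * Y + a3 * (P + m * Q)) (begin
      a1 * X + m * (a1 * B)                  ≡⟨ solve (a1 ∷ X ∷ m ∷ B ∷ []) ⟩
      a1 * (X + m * B)                       ≡⟨ cong (a1 *_) hX ⟩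
      a1 * A                                 ≡⟨ P-eq ⟩
      a2 * A' + a3 * P                       ≡⟨ cong (λ v → a2 * v + a3 * P) hY ⟨
      a2 * (Y + m * B') + a3 * P             ≡⟨ solve (a2 ∷ Y ∷ m ∷ B' ∷ a3 ∷ P ∷ []) ⟩
      a2 * Y + a3 * P + m * (a2 * B')        ≡⟨ cong (λ v → a2 * Y + a3 * P + m * v) Q-eq ⟩
      a2 * Y + a3 * P + m * (a1 * B + a3 * Q) ≡⟨ solve (a1 ∷ a2 ∷ a3 ∷ Y ∷ m ∷ B ∷ P ∷ Q ∷ []) ⟩
      a2 * Y + a3 * (P + m * Q) + m * (a1 * B) ∎)
  ; det = +-cancelʳ-≡ (m * (B * B')) (B' * X) (a3 + Y * B) (begin
      B' * X + m * (B * B')                  ≡⟨ solve (B' ∷ X ∷ m ∷ B ∷ []) ⟩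
      (X + m * B) * B'                       ≡⟨ cong (_* B') hX ⟩
      A * B'                                 ≡⟨ det ⟩
      a3 + B * A'                            ≡⟨ cong (λ v → a3 + B * v) hY ⟨
      a3 + B * (Y + m * B')                  ≡⟨ solve (a3 ∷ B ∷ Y ∷ m ∷ B' ∷ []) ⟩
      a3 + Y * B + m * (B * B') ∎)
  }
  where open ≡-Reasoning

swap : State → State
swap s = st (b'Prev s) (b' s) (bPrev s) (b s)

quot*≤ : ∀ x n → quot x n * n ≤ x
quot*≤ x zero    = z≤n
quot*≤ x (suc n) = m/n*n≤m x (suc n)

quot-pos : ∀ {x n} → 0 < n → n ≤ x → 1 ≤ quot x n
quot-pos {x} {suc n} _ n≤x = m≥n⇒m/n>0 n≤x

multiplier : State → ℕ
multiplier s = q s ⊓ q' s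

multiplier-b : ∀ s → multiplier s * b s ≤ bPrev s
multiplier-b s = ≤-trans (*-monoˡ-≤ (b s) (m⊓n≤m (q s) (q' s))) (quot*≤ (bPrev s) (b s))

multiplier-b' : ∀ s → multiplier s * b' s ≤ b'Prev s
multiplier-b' s = ≤-trans (*-monoˡ-≤ (b' s) (m⊓n≤n (q s) (q' s))) (quot*≤ (b'Prev s) (b' s))

basis-next : ∀ {a1 a2 a3 s} → LatticeBasis a1 a2 a3 s → LatticeBasis a2 a1 a3 (swap (step s))
basis-next {s = s} = basis-step (multiplier s) _ _ (m∸n+n≡m (multiplier-b s)) (m∸n+n≡m (multiplier-b' s))

basis-next-swapped : ∀ {a1 a2 a3 s} → LatticeBasis a2 a1 a3 (swap s) → LatticeBasis a1 a2 a3 (step s)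
basis-next-swapped {s = s} = basis-step (multiplier s) _ _ (m∸n+n≡m (multiplier-b' s)) (m∸n+n≡m (multiplier-b s))

next-positive : ∀ {a1 a2 a3 s} (β : LatticeBasis a1 a2 a3 s) → Positive β → Positive (basis-next β)
next-positive β (P-pos , Q-pos) = Q-pos , ≤-trans P-pos (m≤m+n (P β) _)

next-swapped-positive : ∀ {a1 a2 a3 s} (β : LatticeBasis a2 a1 a3 (swap s)) → Positive β → Positive (basis-next-swapped {s = s} β)
next-swapped-positive β (P-pos , Q-pos) = Q-pos , ≤-trans P-pos (m≤m+n (P β) _)

Halted : State → Set
Halted s = (b s ≡ 0 ⊎ b' s ≡ 0) ⊎ ((b s < bPrev s × b'Prev s ≤ b' s) ⊎ (b' s < b'Prev s × bPrev s ≤ b s))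

halted-swap : ∀ {s} → Halted s → Halted (swap s)
halted-swap = Sum.map Sum.swap Sum.swap

step-by-smaller-quotient : ∀ x n x' n' → n ≢ 0 → quot x n < quot x' n' →
                           x ∸ quot x n * n < n × n' ≤ x' ∸ quot x n * n'
step-by-smaller-quotient x zero    x' n' n≢0 _  = ⊥-elim (n≢0 refl)
step-by-smaller-quotient x (suc n) x' n' _   lt =
  subst (_< suc n) (m%n≡m∸m/n*n x (suc n)) (m%n<n x (suc n)) ,
  m+n≤o⇒m≤o∸n n' (≤-trans (*-monoˡ-≤ n' lt) (quot*≤ x' n'))

step-halted : ∀ s → b s ≢ 0 → b' s ≢ 0 → q s ≢ q' s → Halted (step s)
step-halted s b≢0 b'≢0 q≢q' with <-cmp (q s) (q' s)
... | tri< lt _ _ = inj₂ (inj₁ (subst (λ m → bPrev s ∸ m * b s < b s × b' s ≤ b'Prev s ∸ m * b' s)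
                                       (sym (m≤n⇒m⊓n≡m (<⇒≤ lt)))
                                       (step-by-smaller-quotient (bPrev s) (b s) (b'Prev s) (b' s) b≢0 lt)))
... | tri≈ _ eq _ = ⊥-elim (q≢q' eq)
... | tri> _ _ gt = inj₂ (inj₂ (subst (λ m → b'Prev s ∸ m * b' s < b' s × b s ≤ bPrev s ∸ m * b s)
                                       (sym (m≥n⇒m⊓n≡n (<⇒≤ gt)))
                                       (step-by-smaller-quotient (b'Prev s) (b' s) (bPrev s) (b s) b'≢0 gt)))

halts⇒halted : ∀ {a1 a2 b0 b'0 k} → HaltsAfter a1 a2 b0 b'0 k → Halted (sts a1 a2 b0 b'0 k)
halts⇒halted (inj₁ (_ , zero-b)) = inj₁ zero-b
halts⇒halted {a1} {a2} {b0} {b'0} (inj₂ (j , refl , _ , b≢0 , b'≢0 , q≢q')) =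
  step-halted (sts a1 a2 b0 b'0 j) b≢0 b'≢0 q≢q'

basis-LShaped : ∀ {a1 a2 a3 s} .{{_ : NonZero a3}} → LatticeBasis a1 a2 a3 s → Halted s → LShaped s
basis-LShaped β (inj₁ (inj₁ b≡0)) = inj₂ b≡0
basis-LShaped {a3 = a3} {s} β (inj₁ (inj₂ b'≡0)) = ⊥-elim (<⇒≢ (<-≤-trans (>-nonZero⁻¹ a3) (m≤m+n a3 _)) (begin
  0                      ≡⟨ *-zeroʳ (bPrev s) ⟨
  bPrev s * 0            ≡⟨ cong (bPrev s *_) b'≡0 ⟨
  bPrev s * b' s         ≡⟨ det β ⟩
  a3 + b s * b'Prev s ∎))
  where open ≡-Reasoning
basis-LShaped β (inj₂ (inj₁ (b<bPrev , b'Prev≤b'))) = inj₁ (<⇒≤ b<bPrev , b'Prev≤b')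
basis-LShaped {a3 = a3} {s} β (inj₂ (inj₂ (b'<b'Prev , bPrev≤b))) = ⊥-elim (<-irrefl refl (begin-strict
  bPrev s * b' s         ≤⟨ *-monoˡ-≤ (b' s) bPrev≤b ⟩
  b s * b' s             ≤⟨ *-monoʳ-≤ (b s) (<⇒≤ b'<b'Prev) ⟩
  b s * b'Prev s         <⟨ m<n+m (b s * b'Prev s) (>-nonZero⁻¹ a3) ⟩
  a3 + b s * b'Prev s    ≡⟨ det β ⟨
  bPrev s * b' s ∎))
  where open ≤-Reasoning

RepPos-swap : ∀ a1 a2 a3 n → RepPos a2 a1 a3 n → RepPos a1 a2 a3 n
RepPos-swap a1 a2 a3 n (y1 , y2 , y3 , e) =
  y2 , y1 , y3 , trans e (cong (λ v → ℤ.+ (v + a3 * suc y3)) (+-comm (a2 * suc y1) (a1 * suc y2)))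

IsG-swap : ∀ {a1 a2 a3 g} → IsG a2 a1 a3 g → IsG a1 a2 a3 g
IsG-swap {a1} {a2} {a3} {g} (unrep , rep) =
  unrep ∘ RepPos-swap a2 a1 a3 g , λ n g<n → RepPos-swap a1 a2 a3 n (rep n g<n)

evenFormula-swap : ∀ a1 a2 s → evenFormula a2 a1 (swap s) ≡ oddFormula a1 a2 s
evenFormula-swap a1 a2 s = cong₂ (λ u v → ℤ.+ u ℤ.- ℤ.+ v)
  (+-comm (b'Prev s * a2) (b s * a1)) (⊓-comm (b' s * a2) (bPrev s * a1))

module Iteration (a1 a2 a3 b0 b'0 : ℕ) .{{_ : NonZero a3}} (coprime : Bézout.Identity 1 a1 a2)
  (b'0-pos : 0 < b'0) (b'0≤a1 : b'0 ≤ a1) (a3-eq : a3 + a1 * b0 ≡ a2 * b'0) (b0-pos : 0 < b0) where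

  S : ℕ → State
  S = sts a1 a2 b0 b'0

  basis₀ : LatticeBasis a1 a2 a3 (S 0)
  basis₀ = record
    { P = 0
    ; Q = 1
    ; P-eq = begin a1 * a2 ≡⟨ solve (a1 ∷ a2 ∷ a3 ∷ []) ⟩ a2 * a1 + a3 * 0 ∎
    ; Q-eq = trans (sym a3-eq) (trans (+-comm a3 (a1 * b0)) (cong (a1 * b0 +_) (sym (*-identityʳ a3))))
    ; det = trans (sym a3-eq) (cong (a3 +_) (*-comm a1 b0))
    }
    where open ≡-Reasoning

  b0≤a2 : b0 ≤ a2
  b0≤a2 = <⇒≤ (*-cancelˡ-< a1 b0 a2 (begin-strict
    a1 * b0       <⟨ m<n+m (a1 * b0) (>-nonZero⁻¹ a3) ⟩
    a3 + a1 * b0  ≡⟨ a3-eq ⟩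
    a2 * b'0      ≤⟨ *-monoʳ-≤ a2 b'0≤a1 ⟩
    a2 * a1       ≡⟨ *-comm a2 a1 ⟩
    a1 * a2 ∎))
    where open ≤-Reasoning

  multiplier₀-pos : 1 ≤ multiplier (S 0)
  multiplier₀-pos = ⊓-glb (quot-pos b0-pos b0≤a2) (quot-pos b'0-pos b'0≤a1)

  odd-basis  : ∀ h → Σ (LatticeBasis a2 a1 a3 (swap (S (1 + h * 2)))) Positive
  even-basis : ∀ h → Σ (LatticeBasis a1 a2 a3 (S (2 + h * 2))) Positive
  odd-basis zero    = basis-next basis₀ , s≤s z≤n , ≤-trans multiplier₀-pos (≤-reflexive (sym (*-identityʳ _)))
  odd-basis (suc h) = let β , pos = even-basis h in basis-next β , next-positive β pos
  even-basis h      = let β , pos = odd-basis h in basis-next-swapped β , next-swapped-positive β pos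

  not-halted-at-start : ¬ HaltsAfter a1 a2 b0 b'0 0
  not-halted-at-start (inj₁ (_ , inj₁ b0≡0))   = <⇒≢ b0-pos (sym b0≡0)
  not-halted-at-start (inj₁ (_ , inj₂ b'0≡0))  = <⇒≢ b'0-pos (sym b'0≡0)
  not-halted-at-start (inj₂ (_ , () , _))

  odd-case : ∀ {k} h → k ≡ 1 + h * 2 → HaltsAfter a1 a2 b0 b'0 k → IsG a1 a2 a3 (oddFormula a1 a2 (S k))
  odd-case h refl halts =
    let β , pos = odd-basis h
    in IsG-swap {a1} {a2} {a3} (subst (IsG a2 a1 a3) (evenFormula-swap a1 a2 (S (1 + h * 2)))
         (frobenius-of-basis (Bézout.Identity.sym coprime) β pos (basis-LShaped β (halted-swap (halts⇒halted halts)))))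

  even-case : ∀ {k} h → k ≡ h * 2 → HaltsAfter a1 a2 b0 b'0 k → IsG a1 a2 a3 (evenFormula a1 a2 (S k))
  even-case zero    refl halts = ⊥-elim (not-halted-at-start halts)
  even-case (suc h) refl halts =
    let β , pos = even-basis h
    in frobenius-of-basis coprime β pos (basis-LShaped β (halts⇒halted halts))

theorem10 : (a1 a2 a3 b0 b'0 k : ℕ) →
    0 < a1 → a1 < a2 → a2 < a3 → gcd a1 a2 ≡ 1 →
    0 < b'0 → b'0 ≤ a1 → a3 + a1 * b0 ≡ a2 * b'0 → 0 < b0 →
    HaltsAfter a1 a2 b0 b'0 k →
    (k % 2 ≡ 1 → IsG a1 a2 a3 (oddFormula a1 a2 (sts a1 a2 b0 b'0 k)))
    × (k % 2 ≡ 0 → IsG a1 a2 a3 (evenFormula a1 a2 (sts a1 a2 b0 b'0 k)))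
theorem10 a1 a2 a3 b0 b'0 k _ _ a2<a3 gcd≡1 b'0-pos b'0≤a1 a3-eq b0-pos halts =
  (λ k%2≡1 → odd-case (k / 2) (k-parity k%2≡1) halts) ,
  (λ k%2≡0 → even-case (k / 2) (k-parity k%2≡0) halts)
  where
  instance
    a3≢0 : NonZero a3
    a3≢0 = >-nonZero (<-≤-trans z<s a2<a3)
  coprime : Bézout.Identity 1 a1 a2
  coprime = Bézout.identity (subst (GCD a1 a2) gcd≡1 (gcd-GCD a1 a2))
  open Iteration a1 a2 a3 b0 b'0 coprime b'0-pos b'0≤a1 a3-eq b0-pos
  k-parity : ∀ {r} → k % 2 ≡ r → k ≡ r + k / 2 * 2
  k-parity k%2≡r = trans (m≡m%n+[m/n]*n k 2) (cong (_+ k / 2 * 2) k%2≡r)
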